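{- For every integer $k\ge 1$, the graph $S_k$ is $(4k+2)$-edge-connected and $(4k+2)$-regular.
   Context: Graphs may have parallel edges, no loops; for a set $F$ of vertex pairs and integer $t$, $tF$ means each pair in $F$ is taken as $t$ parallel edges. $S_k$ has vertex set $\{x_i,y_i,z_i: 1\le i\le 4k+2\}\cup\{w\}$ and edge set $A_k\cup kB_k\cup (k+1)C_k\cup(2k+1)(D_k\cup E_k)$, where $A_k=\{wz_i:1\le i\le 4k+2\}$, $B_k=\{z_ix_i,z_iy_i:1\le i\le 4k+2\}$, $C_k=\{x_iy_i:1\le i\le 4k+2\}$, $D_k=\{y_ix_{i+1}:1\le i\le 4k+2\}$, $E_k=\{z_iz_{i+2k+1}:1\le i\le 2k+1\}$, with indices taken modulo $4k+2$. A graph is $r$-edge-connected if at least $r$ edges join $X$ to its complement for every nonempty proper vertex subset $X$. -}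

module Defs where

open import Data.Nat using (ℕ; zero; suc; _+_; _*_; _≤_)
open import Data.Nat.DivMod using (_mod_)
open import Data.Fin using (Fin)
open import Data.Fin.Properties using () renaming (_≟_ to _≟F_)
open import Data.Bool using (Bool; true; false; _∨_; _xor_)
open import Data.List using (List; []; _∷_; _++_; map; concatMap; replicate; upTo)
open import Data.Product using (_×_; _,_; ∃)
open import Relation.Binary.PropositionalEquality using (_≡_)
open import Relation.Nullary.Decidable using (⌊_⌋)

-- A multigraph on vertex type V is given by its list of edges; an edge
-- is an unordered pair of vertices written as an ordered pair, and
-- parallel edges are repeated entries of the list.

countB : {A : Set} → (A → Bool) → List A → ℕ
countB p [] = 0
countB p (a ∷ as) with p a
... | true  = suc (countB p as)
... | false = countB p as

-- number of edges incident with v (graphs here have no loops)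
degree : {V : Set} → (V → V → Bool) → List (V × V) → V → ℕ
degree eq E v = countB (λ { (a , b) → eq a v ∨ eq b v }) E

cut : {V : Set} → List (V × V) → (V → Bool) → ℕ
cut E X = countB (λ { (a , b) → X a xor X b }) E

Regular : {V : Set} → (V → V → Bool) → List (V × V) → ℕ → Set
Regular eq E r = ∀ v → degree eq E v ≡ r

EdgeConnected : {V : Set} → List (V × V) → ℕ → Set
EdgeConnected {V} E r =
  (X : V → Bool) → ∃ (λ u → X u ≡ true) → ∃ (λ u → X u ≡ false) → r ≤ cut E X

N : ℕ → ℕ
N k = 2 + 4 * k

data Vtx (k : ℕ) : Set where
  x y z : Fin (N k) → Vtx k
  w     : Vtx k

_==_ : {k : ℕ} → Vtx k → Vtx k → Bool
x i == x j = ⌊ i ≟F j ⌋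
y i == y j = ⌊ i ≟F j ⌋
z i == z j = ⌊ i ≟F j ⌋
w   == w   = true
_   == _   = false

ix : (k : ℕ) → ℕ → Fin (N k)
ix k i = i mod N k

range1 : ℕ → List ℕ
range1 m = map suc (upTo m)

mult : {A : Set} → ℕ → List A → List A
mult t F = concatMap (replicate t) F

A-edges B-edges C-edges D-edges E-edges : (k : ℕ) → List (Vtx k × Vtx k)
A-edges k = map (λ i → (w , z (ix k i))) (range1 (N k))
B-edges k = concatMap (λ i → (z (ix k i) , x (ix k i)) ∷ (z (ix k i) , y (ix k i)) ∷ []) (range1 (N k))
C-edges k = map (λ i → (x (ix k i) , y (ix k i))) (range1 (N k))
D-edges k = map (λ i → (y (ix k i) , x (ix k (i + 1)))) (range1 (N k))
E-edges k = map (λ i → (z (ix k i) , z (ix k (i + (2 * k + 1))))) (range1 (2 * k + 1))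

S-edges : (k : ℕ) → List (Vtx k × Vtx k)
S-edges k = A-edges k ++ mult k (B-edges k) ++ mult (k + 1) (C-edges k)
            ++ mult (2 * k + 1) (D-edges k ++ E-edges k)

-- A vertex set X cuts a + k·b + (k+1)·c + (2k+1)·(d+e) edges, where a, …, e count the cut
-- pairs of A, …, E. Complementing X if necessary, w ∉ X. If the x's and y's do not all lie on
-- one side, the cycle x₁ y₁ x₂ y₂ ⋯ formed by C ∪ D is cut at least twice, and every cut pair
-- x_i y_i forces a cut pair z_i x_i or z_i y_i, so c ≤ b and the count is ≥ (2k+1)(c+d) ≥ 4k+2.
-- If they all lie in X, each z_i cuts wz_i or the k copies of z_i x_i, so a + k·b ≥ 4k+2. If
-- none does, X consists of z's: then b = 2a, the count is ≥ (2k+1)(a+e), and a + e ≥ 2 because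
-- a lone z_i in X is separated from its chord partner z_{i±(2k+1)}. Regularity is a direct count,
-- since every index occurs exactly once in each class.
module Submission where

open import Defs
open import Data.Bool using (Bool; true; false; not; _∨_; _xor_; T)
open import Data.Bool.Properties
  using (∨-identityʳ; ∨-zeroʳ; xor-same; xor-comm; xor-identityʳ; not-involutive; ¬-not; T-≡)
  renaming (_≟_ to _≟ᵇ_)
open import Data.Empty using (⊥-elim)
open import Data.Fin using (Fin; toℕ)
open import Data.Fin.Properties using (toℕ-fromℕ<; toℕ-injective; toℕ<n; fromℕ<-cong) renaming (_≟_ to _≟F_)
open import Data.List using (List; []; _∷_; _++_; map; concatMap; replicate; applyUpTo; upTo)
open import Data.List.Properties using (map-upTo; map-applyUpTo)
open import Data.Nat
open import Data.Nat.DivMod using (_mod_; _%_; [m+n]%n≡m%n; m<n⇒m%n≡m)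
open import Data.Nat.Properties
open import Data.Nat.Tactic.RingSolver using (solve-∀)
open import Algebra.Properties.CommutativeSemigroup +-commutativeSemigroup using (interchange)
open import Data.Product using (_×_; _,_; ∃)
open import Data.Sum using (_⊎_; inj₁; inj₂)
open import Function using (_∘_; Equivalence)
open import Relation.Binary.PropositionalEquality
open import Relation.Nullary using (Dec; yes; no; ¬_)
open import Relation.Nullary.Decidable using (⌊_⌋; toWitness)

𝟙[_] : Bool → ℕ
𝟙[ true  ] = 1
𝟙[ false ] = 0

𝟙-xor-triangle : ∀ a b c → 𝟙[ a xor c ] ≤ 𝟙[ a xor b ] + 𝟙[ b xor c ]
𝟙-xor-triangle true  true  c     = ≤-refl
𝟙-xor-triangle false false c     = ≤-refl
𝟙-xor-triangle true  false true  = z≤n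
𝟙-xor-triangle true  false false = s≤s z≤n
𝟙-xor-triangle false true  true  = s≤s z≤n
𝟙-xor-triangle false true  false = z≤n

∑< : ℕ → (ℕ → ℕ) → ℕ
∑< zero    f = 0
∑< (suc n) f = f 0 + ∑< n (f ∘ suc)

syntax ∑< n (λ i → e) = ∑[ i < n ] e

∑<-cong : ∀ n {f g : ℕ → ℕ} → (∀ {i} → i < n → f i ≡ g i) → ∑< n f ≡ ∑< n g
∑<-cong zero    eq = refl
∑<-cong (suc n) eq = cong₂ _+_ (eq z<s) (∑<-cong n (eq ∘ s<s))

∑<-mono-≤ : ∀ n {f g : ℕ → ℕ} → (∀ {i} → i < n → f i ≤ g i) → ∑< n f ≤ ∑< n g
∑<-mono-≤ zero    le = z≤n
∑<-mono-≤ (suc n) le = +-mono-≤ (le z<s) (∑<-mono-≤ n (le ∘ s<s))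

∑<-distrib-+ : ∀ n (f g : ℕ → ℕ) → ∑[ i < n ] (f i + g i) ≡ ∑< n f + ∑< n g
∑<-distrib-+ zero    f g = refl
∑<-distrib-+ (suc n) f g = begin
  f 0 + g 0 + ∑[ i < n ] (f (suc i) + g (suc i))   ≡⟨ cong (f 0 + g 0 +_) (∑<-distrib-+ n (f ∘ suc) (g ∘ suc)) ⟩
  f 0 + g 0 + (∑< n (f ∘ suc) + ∑< n (g ∘ suc))   ≡⟨ interchange (f 0) (g 0) _ _ ⟩
  f 0 + ∑< n (f ∘ suc) + (g 0 + ∑< n (g ∘ suc))   ∎
  where open ≡-Reasoning

*-distribˡ-∑< : ∀ n t (f : ℕ → ℕ) → ∑[ i < n ] (t * f i) ≡ t * ∑< n f
*-distribˡ-∑< zero    t f = sym (*-zeroʳ t)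
*-distribˡ-∑< (suc n) t f =
  trans (cong (t * f 0 +_) (*-distribˡ-∑< n t (f ∘ suc))) (sym (*-distribˡ-+ t (f 0) _))

∑<-zero : ∀ n → ∑[ i < n ] 0 ≡ 0
∑<-zero zero    = refl
∑<-zero (suc n) = ∑<-zero n

∑<-one : ∀ n → ∑[ i < n ] 1 ≡ n
∑<-one zero    = refl
∑<-one (suc n) = cong suc (∑<-one n)

∑<-+ : ∀ m n (f : ℕ → ℕ) → ∑< (m + n) f ≡ ∑< m f + ∑[ i < n ] f (m + i)
∑<-+ zero    n f = refl
∑<-+ (suc m) n f = trans (cong (f 0 +_) (∑<-+ m n (f ∘ suc))) (sym (+-assoc (f 0) _ _))

∑<-suc : ∀ n (f : ℕ → ℕ) → ∑< (suc n) f ≡ ∑< n f + f n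
∑<-suc zero    f = +-comm (f 0) 0
∑<-suc (suc n) f = trans (cong (f 0 +_) (∑<-suc n (f ∘ suc))) (sym (+-assoc (f 0) _ _))

f≤∑< : ∀ {n t} (f : ℕ → ℕ) → t < n → f t ≤ ∑< n f
f≤∑< {suc n} {zero}  f _         = m≤m+n (f 0) _
f≤∑< {suc n} {suc t} f (s<s t<n) = ≤-trans (f≤∑< (f ∘ suc) t<n) (m≤n+m _ (f 0))

∑<-rotate : ∀ n (f : ℕ → ℕ) → f n ≡ f 0 → ∑[ i < n ] f (suc i) ≡ ∑< n f
∑<-rotate n f fn≡f0 = +-cancelʳ-≡ (f 0) _ _ (begin
  ∑[ i < n ] f (suc i) + f 0   ≡⟨ +-comm _ (f 0) ⟩
  ∑< (suc n) f                 ≡⟨ ∑<-suc n f ⟩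
  ∑< n f + f n                 ≡⟨ cong (∑< n f +_) fn≡f0 ⟩
  ∑< n f + f 0                 ∎)
  where open ≡-Reasoning

∑<-shift-periodic : ∀ n (f : ℕ → ℕ) → (∀ i → f (n + i) ≡ f i) → ∀ s → ∑[ i < n ] f (s + i) ≡ ∑< n f
∑<-shift-periodic n f periodic zero    = refl
∑<-shift-periodic n f periodic (suc s) =
  trans (∑<-shift-periodic n (f ∘ suc) (λ i → trans (cong f (sym (+-suc n i))) (periodic (suc i))) s)
        (∑<-rotate n f (trans (cong f (sym (+-identityʳ n))) (periodic 0)))

∑<-𝟙-witness : ∀ n (b : ℕ → Bool) → 0 < ∑[ i < n ] 𝟙[ b i ] → ∃ λ t → t < n × T (b t)
∑<-𝟙-witness (suc n) b pos with b 0 in b0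
... | true  = 0 , z<s , Equivalence.from T-≡ b0
... | false with ∑<-𝟙-witness n (b ∘ suc) pos
...   | t , t<n , bt = suc t , s<s t<n , bt

module _ {A : Set} (p : A → Bool) where

  countB-∷ : ∀ a as → countB p (a ∷ as) ≡ 𝟙[ p a ] + countB p as
  countB-∷ a as with p a
  ... | true  = refl
  ... | false = refl

  countB-++ : ∀ as bs → countB p (as ++ bs) ≡ countB p as + countB p bs
  countB-++ []       bs = refl
  countB-++ (a ∷ as) bs with p a
  ... | true  = cong suc (countB-++ as bs)
  ... | false = countB-++ as bs

  countB-replicate : ∀ t a → countB p (replicate t a) ≡ t * 𝟙[ p a ]
  countB-replicate zero    a = refl
  countB-replicate (suc t) a = trans (countB-∷ a _) (cong (𝟙[ p a ] +_) (countB-replicate t a))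

  countB-mult : ∀ t as → countB p (mult t as) ≡ t * countB p as
  countB-mult t []       = sym (*-zeroʳ t)
  countB-mult t (a ∷ as) = begin
    countB p (replicate t a ++ mult t as)   ≡⟨ countB-++ (replicate t a) _ ⟩
    countB p (replicate t a) + countB p (mult t as)
      ≡⟨ cong₂ _+_ (countB-replicate t a) (countB-mult t as) ⟩
    t * 𝟙[ p a ] + t * countB p as           ≡⟨ *-distribˡ-+ t _ _ ⟨
    t * (𝟙[ p a ] + countB p as)            ≡⟨ cong (t *_) (countB-∷ a as) ⟨
    t * countB p (a ∷ as)                   ∎
    where open ≡-Reasoning

  countB-pair : ∀ a b → countB p (a ∷ b ∷ []) ≡ 𝟙[ p a ] + 𝟙[ p b ]
  countB-pair a b =
    trans (countB-∷ a _) (cong (𝟙[ p a ] +_) (trans (countB-∷ b []) (+-identityʳ _)))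

  countB-applyUpTo : ∀ (f : ℕ → A) n → countB p (applyUpTo f n) ≡ ∑[ i < n ] 𝟙[ p (f i) ]
  countB-applyUpTo f zero    = refl
  countB-applyUpTo f (suc n) = trans (countB-∷ (f 0) _) (cong (𝟙[ p (f 0) ] +_) (countB-applyUpTo (f ∘ suc) n))

  countB-concatMap-applyUpTo : ∀ (g : ℕ → List A) h n →
    countB p (concatMap g (applyUpTo h n)) ≡ ∑[ i < n ] countB p (g (h i))
  countB-concatMap-applyUpTo g h zero    = refl
  countB-concatMap-applyUpTo g h (suc n) =
    trans (countB-++ (g (h 0)) _) (cong (countB p (g (h 0)) +_) (countB-concatMap-applyUpTo g (h ∘ suc) n))

  countB-map-range1 : ∀ (f : ℕ → A) n → countB p (map f (range1 n)) ≡ ∑[ i < n ] 𝟙[ p (f (suc i)) ]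
  countB-map-range1 f n = begin
    countB p (map f (map suc (upTo n)))   ≡⟨ cong (countB p ∘ map f) (map-upTo suc n) ⟩
    countB p (map f (applyUpTo suc n))    ≡⟨ cong (countB p) (map-applyUpTo suc f n) ⟩
    countB p (applyUpTo (f ∘ suc) n)      ≡⟨ countB-applyUpTo (f ∘ suc) n ⟩
    ∑[ i < n ] 𝟙[ p (f (suc i)) ]         ∎
    where open ≡-Reasoning

  countB-concatMap-range1 : ∀ (g : ℕ → List A) n →
    countB p (concatMap g (range1 n)) ≡ ∑[ i < n ] countB p (g (suc i))
  countB-concatMap-range1 g n =
    trans (cong (countB p ∘ concatMap g) (map-upTo suc n)) (countB-concatMap-applyUpTo g suc n)

countB-cong : ∀ {A : Set} {p q : A → Bool} → (∀ a → p a ≡ q a) → ∀ as → countB p as ≡ countB q as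
countB-cong {p = p} {q} eq []       = refl
countB-cong {p = p} {q} eq (a ∷ as) = begin
  countB p (a ∷ as)            ≡⟨ countB-∷ p a as ⟩
  𝟙[ p a ] + countB p as      ≡⟨ cong₂ _+_ (cong 𝟙[_] (eq a)) (countB-cong eq as) ⟩
  𝟙[ q a ] + countB q as      ≡⟨ countB-∷ q a as ⟨
  countB q (a ∷ as)            ∎
  where open ≡-Reasoning

-- Residues modulo n in a window of n consecutive integers

𝟙[⌊yes⌋] : ∀ {P : Set} (d : Dec P) → P → 𝟙[ ⌊ d ⌋ ] ≡ 1
𝟙[⌊yes⌋] (yes _)  _ = refl
𝟙[⌊yes⌋] (no ¬p) p = ⊥-elim (¬p p)

𝟙[⌊no⌋] : ∀ {P : Set} (d : Dec P) → ¬ P → 𝟙[ ⌊ d ⌋ ] ≡ 0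
𝟙[⌊no⌋] (yes p) ¬p = ⊥-elim (¬p p)
𝟙[⌊no⌋] (no _)  _  = refl

∑𝟙[i≟t]≡0 : ∀ {n t} → n ≤ t → ∑[ i < n ] 𝟙[ ⌊ i ≟ t ⌋ ] ≡ 0
∑𝟙[i≟t]≡0 {zero}      _    = refl
∑𝟙[i≟t]≡0 {suc n} {t} n<t =
  trans (∑<-suc n _) (cong₂ _+_ (∑𝟙[i≟t]≡0 (<⇒≤ n<t)) (𝟙[⌊no⌋] (n ≟ t) (<⇒≢ n<t)))

∑𝟙[i≟t]≡1 : ∀ {n t} → t < n → ∑[ i < n ] 𝟙[ ⌊ i ≟ t ⌋ ] ≡ 1
∑𝟙[i≟t]≡1 {suc n} {t} t<1+n with m<1+n⇒m<n∨m≡n t<1+n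
... | inj₁ t<n  = trans (∑<-suc n _) (cong₂ _+_ (∑𝟙[i≟t]≡1 t<n) (𝟙[⌊no⌋] (n ≟ t) (>⇒≢ t<n)))
... | inj₂ refl = trans (∑<-suc n (λ i → 𝟙[ ⌊ i ≟ n ⌋ ])) (cong₂ _+_ (∑𝟙[i≟t]≡0 {n} ≤-refl) (𝟙[⌊yes⌋] (n ≟ n) refl))

mod-periodic : ∀ n .{{_ : NonZero n}} i → (n + i) mod n ≡ i mod n
mod-periodic n i = fromℕ<-cong _ _ (trans (cong (_% n) (+-comm n i)) ([m+n]%n≡m%n i n)) _ _

toℕ-mod-< : ∀ n .{{_ : NonZero n}} {i} → i < n → toℕ (i mod n) ≡ i
toℕ-mod-< n i<n = trans (toℕ-fromℕ< _) (m<n⇒m%n≡m i<n)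

∑𝟙[s+i-mod-n≟j]≡1 : ∀ n .{{_ : NonZero n}} (j : Fin n) s → ∑[ i < n ] 𝟙[ ⌊ (s + i) mod n ≟F j ⌋ ] ≡ 1
∑𝟙[s+i-mod-n≟j]≡1 n j s = begin
  ∑[ i < n ] 𝟙[ ⌊ (s + i) mod n ≟F j ⌋ ]
    ≡⟨ ∑<-shift-periodic n _ (λ i → cong (λ r → 𝟙[ ⌊ r ≟F j ⌋ ]) (mod-periodic n i)) s ⟩
  ∑[ i < n ] 𝟙[ ⌊ i mod n ≟F j ⌋ ]   ≡⟨ ∑<-cong n index-in-range ⟩
  ∑[ i < n ] 𝟙[ ⌊ i ≟ toℕ j ⌋ ]      ≡⟨ ∑𝟙[i≟t]≡1 (toℕ<n j) ⟩
  1                                  ∎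
  where
  open ≡-Reasoning
  index-in-range : ∀ {i} → i < n → 𝟙[ ⌊ i mod n ≟F j ⌋ ] ≡ 𝟙[ ⌊ i ≟ toℕ j ⌋ ]
  index-in-range {i} i<n with i ≟ toℕ j
  ... | yes i≡j = 𝟙[⌊yes⌋] (i mod n ≟F j) (toℕ-injective (trans (toℕ-mod-< n i<n) i≡j))
  ... | no  i≢j = 𝟙[⌊no⌋] (i mod n ≟F j) (λ eq → i≢j (trans (sym (toℕ-mod-< n i<n)) (cong toℕ eq)))

mod-surjective : ∀ n .{{_ : NonZero n}} (j : Fin n) s → ∃ λ t → t < n × (s + t) mod n ≡ j
mod-surjective n j s with ∑<-𝟙-witness n (λ i → ⌊ (s + i) mod n ≟F j ⌋)
                            (≤-reflexive (sym (∑𝟙[s+i-mod-n≟j]≡1 n j s)))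
... | t , t<n , hit = t , t<n , toWitness hit

S-weight : (k a b c d e : ℕ) → ℕ
S-weight k a b c d e = a + (k * b + ((k + 1) * c + (2 * k + 1) * (d + e)))

S-weight-cong : ∀ {k a a′ b b′ c c′ d d′ e e′} → a ≡ a′ → b ≡ b′ → c ≡ c′ → d ≡ d′ → e ≡ e′ →
                S-weight k a b c d e ≡ S-weight k a′ b′ c′ d′ e′
S-weight-cong refl refl refl refl refl = refl

[2k+1]+[2k+1]≡N : ∀ k → (2 * k + 1) + (2 * k + 1) ≡ 2 + 4 * k
[2k+1]+[2k+1]≡N = solve-∀

4k+2≡[2k+1]*2 : ∀ k → 4 * k + 2 ≡ (2 * k + 1) * 2
4k+2≡[2k+1]*2 = solve-∀

-- #A, …, #E count the pairs of each class satisfying p, without multiplicity; the summand at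
-- i concerns the paper's index i + 1.
module EdgeClasses {k : ℕ} (p : Vtx k × Vtx k → Bool) where

  #A #B #C #D #E : ℕ
  #A = ∑[ i < N k ] 𝟙[ p (w , z (ix k (suc i))) ]
  #B = ∑[ i < N k ] (𝟙[ p (z (ix k (suc i)) , x (ix k (suc i))) ] + 𝟙[ p (z (ix k (suc i)) , y (ix k (suc i))) ])
  #C = ∑[ i < N k ] 𝟙[ p (x (ix k (suc i)) , y (ix k (suc i))) ]
  #D = ∑[ i < N k ] 𝟙[ p (y (ix k (suc i)) , x (ix k (suc i + 1))) ]
  #E = ∑[ i < 2 * k + 1 ] 𝟙[ p (z (ix k (suc i)) , z (ix k (suc i + (2 * k + 1)))) ]

  countB-S-edges-by-class : countB p (S-edges k) ≡
    S-weight k (countB p (A-edges k)) (countB p (B-edges k)) (countB p (C-edges k))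
               (countB p (D-edges k)) (countB p (E-edges k))
  countB-S-edges-by-class = begin
    countB p (A-edges k ++ Bs ++ Cs ++ DEs)
      ≡⟨ countB-++ p (A-edges k) _ ⟩
    countB p (A-edges k) + countB p (Bs ++ Cs ++ DEs)
      ≡⟨ cong (countB p (A-edges k) +_) (countB-++ p Bs _) ⟩
    countB p (A-edges k) + (countB p Bs + countB p (Cs ++ DEs))
      ≡⟨ cong (λ r → countB p (A-edges k) + (countB p Bs + r)) (countB-++ p Cs DEs) ⟩
    countB p (A-edges k) + (countB p Bs + (countB p Cs + countB p DEs))
      ≡⟨ cong (countB p (A-edges k) +_)
              (cong₂ _+_ (countB-mult p k (B-edges k))
                         (cong₂ _+_ (countB-mult p (k + 1) (C-edges k))
                                    (trans (countB-mult p (2 * k + 1) (D-edges k ++ E-edges k))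
                                           (cong ((2 * k + 1) *_) (countB-++ p (D-edges k) (E-edges k)))))) ⟩
    S-weight k (countB p (A-edges k)) (countB p (B-edges k)) (countB p (C-edges k))
               (countB p (D-edges k)) (countB p (E-edges k))
      ∎
    where
    open ≡-Reasoning
    Bs Cs DEs : List (Vtx k × Vtx k)
    Bs = mult k (B-edges k)
    Cs = mult (k + 1) (C-edges k)
    DEs = mult (2 * k + 1) (D-edges k ++ E-edges k)

  countB-S-edges : countB p (S-edges k) ≡ S-weight k #A #B #C #D #E
  countB-S-edges = trans countB-S-edges-by-class (S-weight-cong {k}
    (countB-map-range1 p (λ i → w , z (ix k i)) (N k))
    (trans (countB-concatMap-range1 p (λ i → (z (ix k i) , x (ix k i)) ∷ (z (ix k i) , y (ix k i)) ∷ []) (N k))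
           (∑<-cong (N k) (λ {i} _ → countB-pair p (z (ix k (suc i)) , x (ix k (suc i)))
                                                     (z (ix k (suc i)) , y (ix k (suc i))))))
    (countB-map-range1 p (λ i → x (ix k i) , y (ix k i)) (N k))
    (countB-map-range1 p (λ i → y (ix k i) , x (ix k (i + 1))) (N k))
    (countB-map-range1 p (λ i → z (ix k i) , z (ix k (i + (2 * k + 1)))) (2 * k + 1)))

open EdgeClasses using (countB-S-edges)

-- Regularity

incident : ∀ {k} → Vtx k → Vtx k × Vtx k → Bool
incident v (a , b) = (a == v) ∨ (b == v)

∑𝟙[∨]≡∑[𝟙+𝟙] : ∀ n (a b : ℕ → Bool) → ∑[ i < n ] (𝟙[ a i ] + 𝟙[ b i ]) ≤ 1 →
               ∑[ i < n ] 𝟙[ a i ∨ b i ] ≡ ∑[ i < n ] (𝟙[ a i ] + 𝟙[ b i ])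
∑𝟙[∨]≡∑[𝟙+𝟙] zero    a b _ = refl
∑𝟙[∨]≡∑[𝟙+𝟙] (suc n) a b ≤1 with a 0 | b 0
... | true  | true  = ⊥-elim (n≮0 (s≤s⁻¹ ≤1))
... | true  | false = cong suc (∑𝟙[∨]≡∑[𝟙+𝟙] n (a ∘ suc) (b ∘ suc) (m≤n⇒m≤1+n (s≤s⁻¹ ≤1)))
... | false | true  = cong suc (∑𝟙[∨]≡∑[𝟙+𝟙] n (a ∘ suc) (b ∘ suc) (m≤n⇒m≤1+n (s≤s⁻¹ ≤1)))
... | false | false = ∑𝟙[∨]≡∑[𝟙+𝟙] n (a ∘ suc) (b ∘ suc) ≤1

module _ (k : ℕ) where

  private
    m : ℕ
    m = 2 * k + 1

    weight-x-or-y : ∀ k → k * 1 + ((k + 1) * 1 + (2 * k + 1) * 1) ≡ 4 * k + 2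
    weight-x-or-y = solve-∀

  ∑≡1-by-residue : (j : Fin (N k)) (s : ℕ) {f : ℕ → ℕ} → (∀ i → f i ≡ 𝟙[ ⌊ ix k (s + i) ≟F j ⌋ ]) → ∑< (N k) f ≡ 1
  ∑≡1-by-residue j s eq = trans (∑<-cong (N k) (λ {i} _ → eq i)) (∑𝟙[s+i-mod-n≟j]≡1 (N k) j s)

  #E-of-incident-z≡1 : (j : Fin (N k)) → EdgeClasses.#E {k} (incident (z j)) ≡ 1
  #E-of-incident-z≡1 j = trans (∑𝟙[∨]≡∑[𝟙+𝟙] m a b (≤-reflexive pairs-hit-once)) pairs-hit-once
    where
    a b : ℕ → Bool
    a i = ⌊ ix k (suc i) ≟F j ⌋
    b i = ⌊ ix k (suc i + m) ≟F j ⌋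
    pairs-hit-once : ∑[ i < m ] (𝟙[ a i ] + 𝟙[ b i ]) ≡ 1
    pairs-hit-once = begin
      ∑[ i < m ] (𝟙[ a i ] + 𝟙[ b i ])
        ≡⟨ ∑<-cong m (λ {i} _ → cong (λ t → 𝟙[ a i ] + 𝟙[ ⌊ ix k (suc t) ≟F j ⌋ ]) (+-comm i m)) ⟩
      ∑[ i < m ] (𝟙[ a i ] + 𝟙[ a (m + i) ])   ≡⟨ ∑<-distrib-+ m _ _ ⟩
      ∑[ i < m ] 𝟙[ a i ] + ∑[ i < m ] 𝟙[ a (m + i) ]   ≡⟨ ∑<-+ m m (λ i → 𝟙[ a i ]) ⟨
      ∑[ i < m + m ] 𝟙[ a i ]                   ≡⟨ cong (λ n → ∑[ i < n ] 𝟙[ a i ]) ([2k+1]+[2k+1]≡N k) ⟩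
      ∑[ i < N k ] 𝟙[ a i ]                     ≡⟨ ∑≡1-by-residue j 1 (λ _ → refl) ⟩
      1                                         ∎
      where open ≡-Reasoning

  S-regular : Regular _==_ (S-edges k) (4 * k + 2)
  S-regular w = trans (countB-S-edges {k} (incident w)) (trans
    (S-weight-cong {k} (∑<-one (N k)) (∑<-zero (N k)) (∑<-zero (N k)) (∑<-zero (N k)) (∑<-zero m))
    (weight-w k))
    where
    weight-w : ∀ k → 2 + 4 * k + (k * 0 + ((k + 1) * 0 + (2 * k + 1) * 0)) ≡ 4 * k + 2
    weight-w = solve-∀
  S-regular (x j) = trans (countB-S-edges {k} (incident (x j))) (trans
    (S-weight-cong {k} (∑<-zero (N k))
      (∑≡1-by-residue j 1 (λ _ → +-identityʳ _))
      (∑≡1-by-residue j 1 (λ _ → cong 𝟙[_] (∨-identityʳ _)))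
      (∑≡1-by-residue j 2 (λ i → cong (λ t → 𝟙[ ⌊ ix k (suc t) ≟F j ⌋ ]) (+-comm i 1)))
      (∑<-zero m))
    (weight-x-or-y k))
  S-regular (y j) = trans (countB-S-edges {k} (incident (y j))) (trans
    (S-weight-cong {k} (∑<-zero (N k))
      (∑≡1-by-residue j 1 (λ _ → refl))
      (∑≡1-by-residue j 1 (λ _ → refl))
      (∑≡1-by-residue j 1 (λ _ → cong 𝟙[_] (∨-identityʳ _)))
      (∑<-zero m))
    (weight-x-or-y k))
  S-regular (z j) = trans (countB-S-edges {k} (incident (z j))) (trans
    (S-weight-cong {k} (∑≡1-by-residue j 1 (λ _ → refl))
      (trans (∑<-distrib-+ (N k) spoke-term spoke-term) (cong₂ _+_ spoke spoke))
      (∑<-zero (N k)) (∑<-zero (N k)) (#E-of-incident-z≡1 j))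
    (weight-z k))
    where
    spoke-term : ℕ → ℕ
    spoke-term i = 𝟙[ ⌊ ix k (suc i) ≟F j ⌋ ∨ false ]
    spoke : ∑< (N k) spoke-term ≡ 1
    spoke = ∑≡1-by-residue j 1 (λ _ → cong 𝟙[_] (∨-identityʳ _))
    weight-z : ∀ k → 1 + (k * 2 + ((k + 1) * 0 + (2 * k + 1) * 1)) ≡ 4 * k + 2
    weight-z = solve-∀

-- Alternating walks

alternations : ℕ → (ℕ → Bool) → (ℕ → Bool) → ℕ
alternations n p q = ∑[ i < n ] (𝟙[ p i xor q i ] + 𝟙[ q i xor p (suc i) ])

𝟙[p₀⊕pₙ]≤alternations : ∀ n (p q : ℕ → Bool) → 𝟙[ p 0 xor p n ] ≤ alternations n p q
𝟙[p₀⊕pₙ]≤alternations zero    p q = ≤-reflexive (cong 𝟙[_] (xor-same (p 0)))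
𝟙[p₀⊕pₙ]≤alternations (suc n) p q = begin
  𝟙[ p 0 xor p (suc n) ]                       ≤⟨ 𝟙-xor-triangle (p 0) (p 1) (p (suc n)) ⟩
  𝟙[ p 0 xor p 1 ] + 𝟙[ p 1 xor p (suc n) ]   ≤⟨ +-mono-≤ (𝟙-xor-triangle (p 0) (q 0) (p 1))
                                                           (𝟙[p₀⊕pₙ]≤alternations n (p ∘ suc) (q ∘ suc)) ⟩
  alternations (suc n) p q                     ∎
  where open ≤-Reasoning

alternations-cons : ∀ n (p q : ℕ → Bool) v r → 𝟙[ p 1 xor v ] + r ≤ alternations n (p ∘ suc) (q ∘ suc) →
                    𝟙[ p 0 xor v ] + r ≤ alternations (suc n) p q
alternations-cons n p q v r h = begin
  𝟙[ p 0 xor v ] + r                           ≤⟨ +-monoˡ-≤ r (𝟙-xor-triangle (p 0) (p 1) v) ⟩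
  𝟙[ p 0 xor p 1 ] + 𝟙[ p 1 xor v ] + r       ≡⟨ +-assoc 𝟙[ p 0 xor p 1 ] _ r ⟩
  𝟙[ p 0 xor p 1 ] + (𝟙[ p 1 xor v ] + r)     ≤⟨ +-mono-≤ (𝟙-xor-triangle (p 0) (q 0) (p 1)) h ⟩
  alternations (suc n) p q                     ∎
  where open ≤-Reasoning

alternations-via-p : ∀ {j n} (p q : ℕ → Bool) → j ≤ n →
                     𝟙[ p 0 xor p j ] + 𝟙[ p j xor p n ] ≤ alternations n p q
alternations-via-p {zero}  {n}     p q _ =
  ≤-trans (≤-reflexive (cong (λ b → 𝟙[ b ] + 𝟙[ p 0 xor p n ]) (xor-same (p 0))))
          (𝟙[p₀⊕pₙ]≤alternations n p q)
alternations-via-p {suc j} {suc n} p q (s≤s j≤n) =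
  alternations-cons n p q (p (suc j)) _ (alternations-via-p (p ∘ suc) (q ∘ suc) j≤n)

alternations-via-q : ∀ {j n} (p q : ℕ → Bool) → j < n →
                     𝟙[ p 0 xor q j ] + 𝟙[ q j xor p n ] ≤ alternations n p q
alternations-via-q {zero}  {suc n} p q _ = begin
  𝟙[ p 0 xor q 0 ] + 𝟙[ q 0 xor p (suc n) ]
    ≤⟨ +-monoʳ-≤ 𝟙[ p 0 xor q 0 ] (𝟙-xor-triangle (q 0) (p 1) (p (suc n))) ⟩
  𝟙[ p 0 xor q 0 ] + (𝟙[ q 0 xor p 1 ] + 𝟙[ p 1 xor p (suc n) ])
    ≤⟨ +-monoʳ-≤ 𝟙[ p 0 xor q 0 ] (+-monoʳ-≤ 𝟙[ q 0 xor p 1 ] (𝟙[p₀⊕pₙ]≤alternations n (p ∘ suc) (q ∘ suc))) ⟩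
  𝟙[ p 0 xor q 0 ] + (𝟙[ q 0 xor p 1 ] + alternations n (p ∘ suc) (q ∘ suc))
    ≡⟨ +-assoc 𝟙[ p 0 xor q 0 ] _ _ ⟨
  alternations (suc n) p q
    ∎
  where open ≤-Reasoning
alternations-via-q {suc j} {suc n} p q (s<s j<n) =
  alternations-cons n p q (q (suc j)) _ (alternations-via-q (p ∘ suc) (q ∘ suc) j<n)

𝟙[b⊕¬b]+𝟙[¬b⊕b]≡2 : ∀ b → 𝟙[ b xor not b ] + 𝟙[ not b xor b ] ≡ 2
𝟙[b⊕¬b]+𝟙[¬b⊕b]≡2 true  = refl
𝟙[b⊕¬b]+𝟙[¬b⊕b]≡2 false = refl

closed-alternations-≥2 : ∀ n (p q : ℕ → Bool) → p n ≡ p 0 →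
  (∃ λ j → j < n × p j ≡ not (p 0)) ⊎ (∃ λ j → j < n × q j ≡ not (p 0)) → 2 ≤ alternations n p q
closed-alternations-≥2 n p q pn≡p0 (inj₁ (j , j<n , pj≡¬p0)) = begin
  2                                        ≡⟨ 𝟙[b⊕¬b]+𝟙[¬b⊕b]≡2 (p 0) ⟨
  𝟙[ p 0 xor not (p 0) ] + 𝟙[ not (p 0) xor p 0 ]
    ≡⟨ cong₂ (λ u v → 𝟙[ p 0 xor u ] + 𝟙[ u xor v ]) (sym pj≡¬p0) (sym pn≡p0) ⟩
  𝟙[ p 0 xor p j ] + 𝟙[ p j xor p n ]    ≤⟨ alternations-via-p p q (<⇒≤ j<n) ⟩
  alternations n p q                       ∎
  where open ≤-Reasoning
closed-alternations-≥2 n p q pn≡p0 (inj₂ (j , j<n , qj≡¬p0)) = begin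
  2                                        ≡⟨ 𝟙[b⊕¬b]+𝟙[¬b⊕b]≡2 (p 0) ⟨
  𝟙[ p 0 xor not (p 0) ] + 𝟙[ not (p 0) xor p 0 ]
    ≡⟨ cong₂ (λ u v → 𝟙[ p 0 xor u ] + 𝟙[ u xor v ]) (sym qj≡¬p0) (sym pn≡p0) ⟩
  𝟙[ p 0 xor q j ] + 𝟙[ q j xor p n ]    ≤⟨ alternations-via-q p q j<n ⟩
  alternations n p q                       ∎
  where open ≤-Reasoning

-- Edge connectivity

module S-weight-bounds {k a b c d e : ℕ} where

  S-weight-≥-cycle : c ≤ b → 2 ≤ c + d → 4 * k + 2 ≤ S-weight k a b c d e
  S-weight-≥-cycle c≤b 2≤c+d = begin
    4 * k + 2                                   ≡⟨ 4k+2≡[2k+1]*2 k ⟩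
    (2 * k + 1) * 2                             ≤⟨ *-monoʳ-≤ (2 * k + 1) 2≤c+d ⟩
    (2 * k + 1) * (c + d)                       ≡⟨ split k c d ⟩
    k * c + ((k + 1) * c + (2 * k + 1) * d)     ≤⟨ +-mono-≤ (*-monoʳ-≤ k c≤b) (+-monoʳ-≤ ((k + 1) * c)
                                                     (*-monoʳ-≤ (2 * k + 1) (m≤m+n d e))) ⟩
    k * b + ((k + 1) * c + (2 * k + 1) * (d + e)) ≤⟨ m≤n+m _ a ⟩
    S-weight k a b c d e                        ∎
    where
    open ≤-Reasoning
    split : ∀ k c d → (2 * k + 1) * (c + d) ≡ k * c + ((k + 1) * c + (2 * k + 1) * d)
    split = solve-∀

  S-weight-≥-spokes : N k ≤ a + k * b → 4 * k + 2 ≤ S-weight k a b c d e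
  S-weight-≥-spokes N≤a+kb = begin
    4 * k + 2                      ≡⟨ +-comm (4 * k) 2 ⟩
    N k                            ≤⟨ N≤a+kb ⟩
    a + k * b                      ≤⟨ +-monoʳ-≤ a (m≤m+n (k * b) _) ⟩
    S-weight k a b c d e           ∎
    where open ≤-Reasoning

  S-weight-≥-chords : b ≡ a + a → 2 ≤ a + e → 4 * k + 2 ≤ S-weight k a b c d e
  S-weight-≥-chords refl 2≤a+e = begin
    4 * k + 2                                   ≡⟨ 4k+2≡[2k+1]*2 k ⟩
    (2 * k + 1) * 2                             ≤⟨ *-monoʳ-≤ (2 * k + 1) 2≤a+e ⟩
    (2 * k + 1) * (a + e)                       ≡⟨ split k a e ⟩
    a + (k * (a + a) + (2 * k + 1) * e)         ≤⟨ +-monoʳ-≤ a (+-monoʳ-≤ (k * (a + a))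
                                                     (≤-trans (*-monoʳ-≤ (2 * k + 1) (m≤n+m e d)) (m≤n+m _ _))) ⟩
    S-weight k a (a + a) c d e                  ∎
    where
    open ≤-Reasoning
    split : ∀ k a e → (2 * k + 1) * (a + e) ≡ a + (k * (a + a) + (2 * k + 1) * e)
    split = solve-∀

crossing : ∀ {V : Set} → (V → Bool) → V × V → Bool
crossing X (a , b) = X a xor X b

not-xor-not : ∀ a b → (not a xor not b) ≡ (a xor b)
not-xor-not true  true  = refl
not-xor-not true  false = refl
not-xor-not false true  = refl
not-xor-not false false = refl

cut-complement : ∀ {V : Set} (E : List (V × V)) (X : V → Bool) → cut E (not ∘ X) ≡ cut E X
cut-complement E X = countB-cong {p = crossing (not ∘ X)} {q = crossing X} (λ (a , b) → not-xor-not (X a) (X b)) E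

constant-or-flips : ∀ (f : ℕ → Bool) b n → (∃ λ j → j < n × f j ≡ not b) ⊎ (∀ {j} → j < n → f j ≡ b)
constant-or-flips f b n with anyUpTo? (λ j → f j ≟ᵇ not b) n
... | yes flip  = inj₁ flip
... | no  ¬flip = inj₂ λ {j} j<n → trans (¬-not (λ fj≡¬b → ¬flip (j , j<n , fj≡¬b))) (not-involutive b)

halves-cover : ∀ m (a : ℕ → Bool) {t} → t < m + m → a t ≡ true → ∃ λ i → i < m × (a i ∨ a (m + i)) ≡ true
halves-cover m a {t} t<2m at with t <? m
... | yes t<m = t , t<m , cong (_∨ a (m + t)) at
... | no  t≮m = t ∸ m , +-cancelˡ-< m _ _ (subst (_< m + m) (sym m+[t∸m]≡t) t<2m)
                      , trans (cong (λ r → a (t ∸ m) ∨ a r) m+[t∸m]≡t) (trans (cong (a (t ∸ m) ∨_) at) (∨-zeroʳ _))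
  where
  m+[t∸m]≡t : m + (t ∸ m) ≡ t
  m+[t∸m]≡t = m+[n∸m]≡n (≮⇒≥ t≮m)

2≤𝟙+𝟙+𝟙[⊕] : ∀ a b → (a ∨ b) ≡ true → 2 ≤ 𝟙[ a ] + 𝟙[ b ] + 𝟙[ a xor b ]
2≤𝟙+𝟙+𝟙[⊕] true  true  _ = ≤-refl
2≤𝟙+𝟙+𝟙[⊕] true  false _ = ≤-refl
2≤𝟙+𝟙+𝟙[⊕] false true  _ = ≤-refl

module CutBound {k : ℕ} (k≥1 : 1 ≤ k) (X : Vtx k → Bool) (Xw≡false : X w ≡ false) where

  open EdgeClasses (crossing X) using (#A; #B; #C; #D; #E)
  open S-weight-bounds {k} {#A} {#B} {#C} {#D} {#E}

  private
    m : ℕ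
    m = 2 * k + 1

  xs ys zs : ℕ → Bool
  xs i = X (x (ix k (suc i)))
  ys i = X (y (ix k (suc i)))
  zs i = X (z (ix k (suc i)))

  #A≡∑zs : #A ≡ ∑[ i < N k ] 𝟙[ zs i ]
  #A≡∑zs = ∑<-cong (N k) (λ {i} _ → cong (λ b → 𝟙[ b xor zs i ]) Xw≡false)

  #C≤#B : #C ≤ #B
  #C≤#B = ∑<-mono-≤ (N k) λ {i} _ → begin
    𝟙[ xs i xor ys i ]                          ≤⟨ 𝟙-xor-triangle (xs i) (zs i) (ys i) ⟩
    𝟙[ xs i xor zs i ] + 𝟙[ zs i xor ys i ]    ≡⟨ cong (λ b → 𝟙[ b ] + 𝟙[ zs i xor ys i ]) (xor-comm (xs i) (zs i)) ⟩
    𝟙[ zs i xor xs i ] + 𝟙[ zs i xor ys i ]    ∎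
    where open ≤-Reasoning

  -- C ∪ D is the cycle x₁ y₁ x₂ y₂ ⋯ x₄ₖ₊₂ y₄ₖ₊₂ x₁.
  #C+#D≡alternations : #C + #D ≡ alternations (N k) xs ys
  #C+#D≡alternations = trans
    (cong (#C +_) (∑<-cong (N k) (λ {i} _ → cong (λ t → 𝟙[ ys i xor X (x (ix k (suc t))) ]) (+-comm i 1))))
    (sym (∑<-distrib-+ (N k) (λ i → 𝟙[ xs i xor ys i ]) (λ i → 𝟙[ ys i xor xs (suc i) ])))

  xs-periodic : xs (N k) ≡ xs 0
  xs-periodic = cong (λ t → X (x t)) (trans (cong (_mod N k) (+-comm 1 (N k))) (mod-periodic (N k) 1))

  cycle-bound : (∃ λ j → j < N k × xs j ≡ not (xs 0)) ⊎ (∃ λ j → j < N k × ys j ≡ not (xs 0)) →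
                4 * k + 2 ≤ S-weight k #A #B #C #D #E
  cycle-bound flip = S-weight-≥-cycle #C≤#B
    (subst (2 ≤_) (sym #C+#D≡alternations) (closed-alternations-≥2 (N k) xs ys xs-periodic flip))

  spokes-bound : (∀ {j} → j < N k → xs j ≡ true) → 4 * k + 2 ≤ S-weight k #A #B #C #D #E
  spokes-bound xs≡true = S-weight-≥-spokes (begin
    N k                                                    ≡⟨ ∑<-one (N k) ⟨
    ∑[ i < N k ] 1                                         ≤⟨ ∑<-mono-≤ (N k) wzᵢ-or-zᵢxᵢ-crossed ⟩
    ∑[ i < N k ] (𝟙[ zs i ] + k * 𝟙[ zs i xor xs i ])
      ≡⟨ ∑<-distrib-+ (N k) (λ i → 𝟙[ zs i ]) (λ i → k * 𝟙[ zs i xor xs i ]) ⟩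
    ∑[ i < N k ] 𝟙[ zs i ] + ∑[ i < N k ] (k * 𝟙[ zs i xor xs i ])
      ≡⟨ cong₂ _+_ (sym #A≡∑zs) (*-distribˡ-∑< (N k) k (λ i → 𝟙[ zs i xor xs i ])) ⟩
    #A + k * ∑[ i < N k ] 𝟙[ zs i xor xs i ]
      ≤⟨ +-monoʳ-≤ #A (*-monoʳ-≤ k (∑<-mono-≤ (N k) (λ {i} _ → m≤m+n 𝟙[ zs i xor xs i ] 𝟙[ zs i xor ys i ]))) ⟩
    #A + k * #B                                            ∎)
    where
    open ≤-Reasoning
    wzᵢ-or-zᵢxᵢ-crossed : ∀ {i} → i < N k → 1 ≤ 𝟙[ zs i ] + k * 𝟙[ zs i xor xs i ]
    wzᵢ-or-zᵢxᵢ-crossed {i} i<N rewrite xs≡true i<N with zs i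
    ... | true  = s≤s z≤n
    ... | false = ≤-trans k≥1 (≤-reflexive (sym (*-identityʳ k)))

  chords-bound : (∀ {j} → j < N k → xs j ≡ false) → (∀ {j} → j < N k → ys j ≡ false) →
                 ∀ {t} → t < N k → zs t ≡ true → 4 * k + 2 ≤ S-weight k #A #B #C #D #E
  chords-bound xs≡false ys≡false {t} t<N zt = S-weight-≥-chords #B≡#A+#A 2≤#A+#E
    where
    open ≤-Reasoning
    zs-only : ∀ {f : ℕ → Bool} → (∀ {i} → i < N k → f i ≡ false) → ∀ {i} → i < N k → 𝟙[ zs i xor f i ] ≡ 𝟙[ zs i ]
    zs-only f≡false {i} i<N = cong 𝟙[_] (trans (cong (zs i xor_) (f≡false i<N)) (xor-identityʳ (zs i)))

    #B≡#A+#A : #B ≡ #A + #A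
    #B≡#A+#A = begin-equality
      #B
        ≡⟨ ∑<-cong (N k) (λ i<N → cong₂ _+_ (zs-only xs≡false i<N) (zs-only ys≡false i<N)) ⟩
      ∑[ i < N k ] (𝟙[ zs i ] + 𝟙[ zs i ])
        ≡⟨ ∑<-distrib-+ (N k) (λ i → 𝟙[ zs i ]) (λ i → 𝟙[ zs i ]) ⟩
      ∑[ i < N k ] 𝟙[ zs i ] + ∑[ i < N k ] 𝟙[ zs i ]
        ≡⟨ cong₂ _+_ #A≡∑zs #A≡∑zs ⟨
      #A + #A
        ∎

    pair-term : ℕ → ℕ
    pair-term i = 𝟙[ zs i ] + 𝟙[ zs (m + i) ] + 𝟙[ zs i xor zs (m + i) ]

    #A+#E≡∑pairs : #A + #E ≡ ∑< m pair-term
    #A+#E≡∑pairs = begin-equality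
      #A + #E
        ≡⟨ cong₂ _+_ (trans #A≡∑zs (cong (λ n → ∑[ i < n ] 𝟙[ zs i ]) (sym ([2k+1]+[2k+1]≡N k))))
                     (∑<-cong m (λ {i} _ → cong (λ r → 𝟙[ zs i xor X (z (ix k (suc r))) ]) (+-comm i m))) ⟩
      ∑[ i < m + m ] 𝟙[ zs i ] + ∑[ i < m ] 𝟙[ zs i xor zs (m + i) ]
        ≡⟨ cong (_+ ∑[ i < m ] 𝟙[ zs i xor zs (m + i) ])
                (trans (∑<-+ m m (λ i → 𝟙[ zs i ])) (sym (∑<-distrib-+ m (λ i → 𝟙[ zs i ]) (λ i → 𝟙[ zs (m + i) ])))) ⟩
      ∑[ i < m ] (𝟙[ zs i ] + 𝟙[ zs (m + i) ]) + ∑[ i < m ] 𝟙[ zs i xor zs (m + i) ]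
        ≡⟨ ∑<-distrib-+ m (λ i → 𝟙[ zs i ] + 𝟙[ zs (m + i) ]) (λ i → 𝟙[ zs i xor zs (m + i) ]) ⟨
      ∑< m pair-term
        ∎

    2≤#A+#E : 2 ≤ #A + #E
    2≤#A+#E with halves-cover m zs (subst (t <_) (sym ([2k+1]+[2k+1]≡N k)) t<N) zt
    ... | i , i<m , zi∨zm+i = begin
      2              ≤⟨ 2≤𝟙+𝟙+𝟙[⊕] (zs i) (zs (m + i)) zi∨zm+i ⟩
      pair-term i    ≤⟨ f≤∑< pair-term i<m ⟩
      ∑< m pair-term ≡⟨ #A+#E≡∑pairs ⟨
      #A + #E        ∎

  uniform-bound : ∀ b → (∀ {j} → j < N k → xs j ≡ b) → (∀ {j} → j < N k → ys j ≡ b) →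
                  ∀ u → X u ≡ true → 4 * k + 2 ≤ S-weight k #A #B #C #D #E
  uniform-bound true  xs≡true _ _ _ = spokes-bound xs≡true
  uniform-bound false _ _ w Xw≡true with trans (sym Xw≡true) Xw≡false
  ... | ()
  uniform-bound false xs≡false _ (x j) Xu with mod-surjective (N k) j 1
  ... | t , t<N , refl with trans (sym Xu) (xs≡false t<N)
  ...   | ()
  uniform-bound false _ ys≡false (y j) Xu with mod-surjective (N k) j 1
  ... | t , t<N , refl with trans (sym Xu) (ys≡false t<N)
  ...   | ()
  uniform-bound false xs≡false ys≡false (z j) Xu with mod-surjective (N k) j 1
  ... | t , t<N , refl = chords-bound xs≡false ys≡false t<N Xu

  4k+2≤cut : ∀ u → X u ≡ true → 4 * k + 2 ≤ cut (S-edges k) X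
  4k+2≤cut u Xu = subst (4 * k + 2 ≤_) (sym (countB-S-edges (crossing X))) bound
    where
    bound : 4 * k + 2 ≤ S-weight k #A #B #C #D #E
    bound with constant-or-flips xs (xs 0) (N k) | constant-or-flips ys (xs 0) (N k)
    ... | inj₁ flip    | _            = cycle-bound (inj₁ flip)
    ... | inj₂ _       | inj₁ flip    = cycle-bound (inj₂ flip)
    ... | inj₂ xs≡xs₀ | inj₂ ys≡xs₀ = uniform-bound (xs 0) xs≡xs₀ ys≡xs₀ u Xu

S-edgeConnected : ∀ {k} → 1 ≤ k → EdgeConnected (S-edges k) (4 * k + 2)
S-edgeConnected {k} k≥1 X (u , Xu) (v , Xv) = on-side-of-w (X w) refl
  where
  on-side-of-w : ∀ b → X w ≡ b → 4 * k + 2 ≤ cut (S-edges k) X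
  on-side-of-w false Xw = CutBound.4k+2≤cut k≥1 X Xw u Xu
  on-side-of-w true  Xw = subst (4 * k + 2 ≤_) (cut-complement (S-edges k) X)
                                (CutBound.4k+2≤cut k≥1 (not ∘ X) (cong not Xw) v (cong not Xv))

lemma3p2 : (k : ℕ) → 1 ≤ k →
    EdgeConnected (S-edges k) (4 * k + 2) × Regular _==_ (S-edges k) (4 * k + 2)
lemma3p2 k k≥1 = S-edgeConnected k≥1 , S-regular k
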